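{- Let $G$ be a threshold graph with $2c$ vertices that has a perfect matching. Consider the greedy algorithm: starting with $G_0=G$, at step $i$ select the edge of maximum weight in $G_i$ (breaking ties by the fixed order on the edges) and let $G_{i+1}$ be obtained from $G_i$ by deleting both endpoints of this edge and all edges incident to them; stop after $c$ edges have been selected. Then the greedy algorithm selects $c$ edges forming a dominant perfect matching of $G$.
   Context: A threshold graph here is an undirected graph $G=(V,E)$ in which each vertex $x$ has a weight $w(x)\ge0$ and, for a threshold $t>0$, $E=\{(x,y):x\ne y,\ w(x)+w(y)\le t\}$. The weight of an edge $(x,y)$ is $w(x)+w(y)$. A fixed arbitrary order on $E$ is used to break ties between edges of equal weight, so that for a perfect matching $A$ the $i$-th heaviest edge $A_i$ is uniquely defined. A perfect matching $A$ dominates a perfect matching $B$ if $\sum_{i=1}^xw(A_i)\ge\sum_{i=1}^xw(B_i)$ for every $x\in\{1,\dots,c\}$; $A$ is a dominant perfect matching if it dominates every perfect matching of $G$.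
   Formalization: The vertex weights $w(x)$ and the threshold $t$ are rational. -}

module Defs where

open import Data.Bool using (Bool; true; false; if_then_else_; _∧_; _∨_)
open import Data.Nat using (ℕ; zero; suc; _≤_; _<ᵇ_) renaming (_+_ to _+ℕ_; _*_ to _*ℕ_; _<_ to _<ℕ_)
open import Data.Fin using (Fin; toℕ)
open import Data.Fin.Properties using () renaming (_≟_ to _≟F_)
open import Data.Rational using (ℚ; 0ℚ; _+_; _<_) renaming (_≤_ to _≤ℚ_)
open import Data.Rational.Properties using (_≤?_; _<?_; _≟_)
open import Data.List using (List; []; _∷_; [_]; concatMap; map; take; foldr; length; allFin)
open import Data.List.Relation.Unary.All using (All)
open import Data.Product using (_×_; _,_; proj₁; proj₂; Σ-syntax)
open import Data.Sum using (_⊎_)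
open import Relation.Nullary using (¬_; does)
open import Relation.Binary.PropositionalEquality using (_≡_; _≢_)

-- An (ordered representation of an) edge: a pair of vertices.
Edge : ℕ → Set
Edge n = Fin n × Fin n

module Threshold {n : ℕ} (w : Fin n → ℚ) (t : ℚ) (ord : Fin n → Fin n → ℕ) where

  Adj : Fin n → Fin n → Set
  Adj x y = x ≢ y × (w x + w y) ≤ℚ t

  -- a tie-breaking order on the edge set E, given as an injective rank
  -- function on unordered edges (smaller rank = preferred)
  IsTieOrder : Set
  IsTieOrder =
    (∀ x y → ord x y ≡ ord y x) ×
    (∀ x y x' y' → Adj x y → Adj x' y' → ord x y ≡ ord x' y' →
       (x ≡ x' × y ≡ y') ⊎ (x ≡ y' × y ≡ x'))

  weight : Edge n → ℚ
  weight (x , y) = w x + w y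

  rank : Edge n → ℕ
  rank (x , y) = ord x y

  ahead : Edge n → Edge n → Bool
  ahead e e' = does (weight e' <? weight e) ∨ (does (weight e ≟ weight e') ∧ (rank e <ᵇ rank e'))

  occ : Fin n → List (Edge n) → ℕ
  occ v [] = 0
  occ v ((a , b) ∷ M) =
    (if does (a ≟F v) then 1 else 0) +ℕ ((if does (b ≟F v) then 1 else 0) +ℕ occ v M)

  IsPerfectMatching : List (Edge n) → Set
  IsPerfectMatching M = All (λ e → Adj (proj₁ e) (proj₂ e)) M × (∀ v → occ v M ≡ 1)

  insert : Edge n → List (Edge n) → List (Edge n)
  insert e [] = [ e ]
  insert e (f ∷ fs) = if ahead e f then e ∷ f ∷ fs else f ∷ insert e fs

  sortEdges : List (Edge n) → List (Edge n)
  sortEdges = foldr insert []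

  sumℚ : List ℚ → ℚ
  sumℚ = foldr _+_ 0ℚ

  topSum : ℕ → List (Edge n) → ℚ
  topSum x M = sumℚ (map weight (take x (sortEdges M)))

  -- A dominates B (c = number of edges of a perfect matching)
  Dominates : ℕ → List (Edge n) → List (Edge n) → Set
  Dominates c A B = ∀ x → 1 ≤ x → x ≤ c → topSum x B ≤ℚ topSum x A

  IsDominantPerfectMatching : ℕ → List (Edge n) → Set
  IsDominantPerfectMatching c A =
    IsPerfectMatching A × (∀ B → IsPerfectMatching B → Dominates c A B)

  candidates : List (Fin n) → List (Edge n)
  candidates rem = concatMap (λ x → concatMap (λ y →
      if (toℕ x <ᵇ toℕ y) ∧ does ((w x + w y) ≤? t) then [ (x , y) ] else []) rem) rem

  best : Edge n → List (Edge n) → Edge n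
  best e [] = e
  best e (f ∷ fs) = best (if ahead f e then f else e) fs

  removeV : Fin n → List (Fin n) → List (Fin n)
  removeV v [] = []
  removeV v (u ∷ us) = if does (u ≟F v) then removeV v us else u ∷ removeV v us

  greedyFrom : ℕ → List (Fin n) → List (Edge n)
  greedyFrom zero rem = []
  greedyFrom (suc k) rem with candidates rem
  ... | [] = []
  ... | e ∷ es = let b = best e es in
                 b ∷ greedyFrom k (removeV (proj₂ b) (removeV (proj₁ b) rem))

  greedy : ℕ → List (Edge n)
  greedy c = greedyFrom c (allFin n)

{-# OPTIONS --safe #-}
-- Let xy be the heaviest edge of the current graph and B any perfect matching of it. Either
-- xy ∈ B, or B matches x to x′ and y to y′. In the latter case w x′ ≤ w y, since xx′ is no
-- heavier than xy, so by the threshold property x′ and y′ are adjacent, and replacing xx′, yy′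
-- by xy, x′y′ yields a perfect matching containing xy. The exchange trades the weights
-- w(xx′), w(yy′) for w(xy), which is at least both, and w(x′y′), keeping the total, so it can
-- only raise the sum of any k of the weights. Induction on the remaining graph shows that
-- any k weights of B are outweighed by some k weights of the greedy matching, which for
-- nonnegative weights is domination of the sums of the k heaviest edges.
module Submission where

open import Defs
open import Algebra.Bundles using (CommutativeMonoid)
import Algebra.Properties.CommutativeMonoid.Sum
import Algebra.Properties.CommutativeSemigroup
open import Data.Bool using (true; false; T; if_then_else_; _∧_; _∨_)
open import Data.Bool.Properties using (T-∧)
open import Data.Empty using (⊥-elim)
open import Data.Fin using (Fin; toℕ)
open import Data.Fin.Properties using (toℕ-injective; punchInᵢ≢i) renaming (_≟_ to _≟F_)
open import Data.List using (List; []; _∷_; [_]; _++_; foldr; length; take; drop; map; allFin)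
open import Data.List.Properties using (take++drop≡id; length-take; length-map; take-map)
open import Data.List.Membership.Propositional using (_∈_; find)
open import Data.List.Membership.Propositional.Properties
  using (∈-∃++; ∈-++⁻; ∈-concatMap⁺; ∈-concatMap⁻; ∈-allFin)
import Data.List.Membership.DecPropositional as DecMembership
open import Data.List.Relation.Unary.All as All using (All; []; _∷_)
import Data.List.Relation.Unary.All.Properties as All
open import Data.List.Relation.Unary.AllPairs using (AllPairs; []; _∷_)
open import Data.List.Relation.Unary.Any as Any using (here; there)
open import Data.List.Relation.Binary.Permutation.Propositional
open import Data.List.Relation.Binary.Permutation.Propositional.Properties
open import Data.List.Relation.Binary.Permutation.Setoid.Properties using (foldr-commMonoid)
open import Data.Nat using (ℕ; zero; suc; _*_; z≤n; s≤s; s≤s⁻¹; _<ᵇ_)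
  renaming (_+_ to _+ℕ_; _≤_ to _≤ℕ_; _<_ to _<ℕ_)
import Data.Nat.Properties as ℕ
open import Data.Nat.Tactic.RingSolver using (solve-∀)
open import Data.Product using (_×_; _,_; proj₁; proj₂; Σ-syntax; ∃-syntax)
open import Data.Rational using (ℚ; 0ℚ; _+_; _≤_; _≥_; _<_)
import Data.Rational.Properties as ℚ
open import Data.Rational.Properties using (_<?_; _≟_; _≤?_)
open import Data.Sum using (_⊎_; inj₁; inj₂)
open import Data.Vec.Functional using (removeAt)
open import Function using (_∘_)
open import Function.Bundles using (Equivalence)
open import Relation.Binary.Definitions using (tri<; tri≈; tri>)
open import Relation.Binary.PropositionalEquality
  using (_≡_; _≢_; refl; sym; cong; cong₂; subst; subst₂; module ≡-Reasoning)
  renaming (trans to ≡-trans)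
open import Relation.Nullary using (¬_; Dec; yes; no; does)

module ℕ+ = Algebra.Properties.CommutativeSemigroup ℕ.+-commutativeSemigroup
module ℚ+ = Algebra.Properties.CommutativeSemigroup
  (CommutativeMonoid.commutativeSemigroup ℚ.+-0-commutativeMonoid)
module ℕ∑ = Algebra.Properties.CommutativeMonoid.Sum ℕ.+-0-commutativeMonoid

-- Domination between bags of weights

∑ : List ℚ → ℚ
∑ = foldr _+_ 0ℚ

∑-↭ : ∀ {xs ys} → xs ↭ ys → ∑ xs ≡ ∑ ys
∑-↭ p = foldr-commMonoid ℚ-+.setoid ℚ-+.isCommutativeMonoid (↭⇒↭ₛ p)
  where module ℚ-+ = CommutativeMonoid ℚ.+-0-commutativeMonoid

module _ {A : Set} where

  ∈⇒↭∷ : ∀ {x : A} {xs} → x ∈ xs → ∃[ ys ] xs ↭ x ∷ ys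
  ∈⇒↭∷ x∈xs with ys , zs , refl ← ∈-∃++ x∈xs = ys ++ zs , shift _ ys zs

  ++-↭-∷⁻ : ∀ {x : A} S R {L} → S ++ R ↭ x ∷ L →
    (∃[ S₀ ] (S ↭ x ∷ S₀ × S₀ ++ R ↭ L)) ⊎ (∃[ R₀ ] (R ↭ x ∷ R₀ × S ++ R₀ ↭ L))
  ++-↭-∷⁻ {x} S R p with ∈-++⁻ S (∈-resp-↭ (↭-sym p) (here refl))
  ... | inj₁ x∈S with S₀ , S↭ ← ∈⇒↭∷ x∈S =
    inj₁ (S₀ , S↭ , drop-∷ (↭-trans (↭-sym (++⁺ʳ R S↭)) p))
  ... | inj₂ x∈R with R₀ , R↭ ← ∈⇒↭∷ x∈R =
    inj₂ (R₀ , R↭ , drop-∷ (↭-trans (↭-sym (shift x S R₀)) (↭-trans (↭-sym (++⁺ˡ S R↭)) p)))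

OutweighedIn : List ℚ → List ℚ → Set
OutweighedIn G S = ∃[ S′ ] ∃[ R′ ] (S′ ++ R′ ↭ G × length S′ ≡ length S × ∑ S ≤ ∑ S′)

infix 4 _≽_

-- Unlike comparing prefix sums of sorted lists, this is invariant under permuting either side,
-- which keeps the exchange step local.
_≽_ : List ℚ → List ℚ → Set
G ≽ B = ∀ S R → S ++ R ↭ B → OutweighedIn G S

≽-trans : ∀ {G H B} → G ≽ H → H ≽ B → G ≽ B
≽-trans G≽H H≽B S R p with S′ , R′ , p′ , len , le ← H≽B S R p
                       with S″ , R″ , p″ , len′ , le′ ← G≽H S′ R′ p′ =
  S″ , R″ , p″ , ≡-trans len′ len , ℚ.≤-trans le le′

≽-respʳ-↭ : ∀ {G B B′} → B ↭ B′ → G ≽ B → G ≽ B′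
≽-respʳ-↭ B↭B′ G≽B S R p = G≽B S R (↭-trans p (↭-sym B↭B′))

≽-respˡ-↭ : ∀ {G G′ B} → G ↭ G′ → G ≽ B → G′ ≽ B
≽-respˡ-↭ G↭G′ G≽B S R p with S′ , R′ , p′ , len , le ← G≽B S R p =
  S′ , R′ , ↭-trans p′ G↭G′ , len , le

[]≽[] : [] ≽ []
[]≽[] [] R p = [] , [] , ↭-refl , refl , ℚ.≤-refl
[]≽[] (x ∷ S) R p with () ← ↭-empty-inv p

≽-prep : ∀ {G B} m → G ≽ B → m ∷ G ≽ m ∷ B
≽-prep m G≽B S R p with ++-↭-∷⁻ S R p
... | inj₁ (S₀ , S↭ , p₀) with S′ , R′ , p′ , len , le ← G≽B S₀ R p₀ =
  m ∷ S′ , R′ , prep m p′ , ≡-trans (cong suc len) (sym (↭-length S↭)) ,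
  subst (_≤ m + ∑ S′) (sym (∑-↭ S↭)) (ℚ.+-monoʳ-≤ m le)
... | inj₂ (R₀ , R↭ , p₀) with S′ , R′ , p′ , len , le ← G≽B S R₀ p₀ =
  S′ , m ∷ R′ , ↭-trans (shift m S′ R′) (prep m p′) , len , le

outweighed-by-raising : ∀ {p m a S S₀ R₁ R} → p ≤ m → S ↭ p ∷ S₀ → S₀ ++ R₁ ↭ R →
  OutweighedIn (m ∷ a ∷ R) S
outweighed-by-raising {m = m} {a} {S₀ = S₀} {R₁} p≤m S↭ P =
  m ∷ S₀ , a ∷ R₁ , prep m (↭-trans (shift a S₀ R₁) (prep a P)) , sym (↭-length S↭) ,
  subst (_≤ m + ∑ S₀) (sym (∑-↭ S↭)) (ℚ.+-monoˡ-≤ (∑ S₀) p≤m)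

exchange-≽ : ∀ {p q m a} R → p ≤ m → q ≤ m → p + q ≡ m + a → m ∷ a ∷ R ≽ p ∷ q ∷ R
exchange-≽ {p} {q} {m} {a} R p≤m q≤m pq≡ma S Rest P with ++-↭-∷⁻ S Rest P
... | inj₁ (S₀ , S↭ , P₀) with ++-↭-∷⁻ S₀ Rest P₀
...   | inj₁ (S₁ , S₀↭ , P₁) =
  m ∷ a ∷ S₁ , Rest , prep m (prep a P₁) ,
  sym (≡-trans (↭-length S↭) (cong suc (↭-length S₀↭))) ,
  ℚ.≤-reflexive (begin
    ∑ S              ≡⟨ ∑-↭ S↭ ⟩
    p + ∑ S₀         ≡⟨ cong (p +_) (∑-↭ S₀↭) ⟩
    p + (q + ∑ S₁)   ≡⟨ sym (ℚ.+-assoc p q (∑ S₁)) ⟩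
    (p + q) + ∑ S₁   ≡⟨ cong (_+ ∑ S₁) pq≡ma ⟩
    (m + a) + ∑ S₁   ≡⟨ ℚ.+-assoc m a (∑ S₁) ⟩
    m + (a + ∑ S₁)   ∎)
  where open ≡-Reasoning
...   | inj₂ (_ , _ , P₁) = outweighed-by-raising p≤m S↭ P₁
exchange-≽ R p≤m q≤m pq≡ma S Rest P | inj₂ (R₀ , _ , P₀) with ++-↭-∷⁻ S R₀ P₀
...   | inj₁ (_ , S↭ , P₁) = outweighed-by-raising q≤m S↭ P₁
...   | inj₂ (R₁ , _ , P₁) =
  S , _ ∷ _ ∷ R₁ , ↭-trans (shift _ S _) (prep _ (↭-trans (shift _ S R₁) (prep _ P₁))) ,
  refl , ℚ.≤-refl

∑-take-nonneg : ∀ {L} → All (0ℚ ≤_) L → ∀ k → 0ℚ ≤ ∑ (take k L)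
∑-take-nonneg _ zero = ℚ.≤-refl
∑-take-nonneg [] (suc k) = ℚ.≤-refl
∑-take-nonneg (0≤x ∷ 0≤L) (suc k) = ℚ.+-mono-≤ 0≤x (∑-take-nonneg 0≤L k)

∑-sub-bag≤∑-take : ∀ {L} → AllPairs _≥_ L → All (0ℚ ≤_) L →
  ∀ k S R → S ++ R ↭ L → length S ≤ℕ k → ∑ S ≤ ∑ (take k L)
∑-sub-bag≤∑-take [] [] k [] R p _ = ∑-take-nonneg [] k
∑-sub-bag≤∑-take [] [] k (x ∷ S) R p _ with () ← ↭-empty-inv p
∑-sub-bag≤∑-take (_ ∷ _) _ zero [] _ _ _ = ℚ.≤-refl
∑-sub-bag≤∑-take {x ∷ L} (x≥L ∷ desc) (0≤x ∷ 0≤L) (suc k) S R p |S|≤k with ++-↭-∷⁻ S R p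
... | inj₁ (S₀ , S↭ , p₀) =
  subst (_≤ x + ∑ (take k L)) (sym (∑-↭ S↭))
    (ℚ.+-monoʳ-≤ x (∑-sub-bag≤∑-take desc 0≤L k S₀ R p₀
      (s≤s⁻¹ (subst (_≤ℕ suc k) (↭-length S↭) |S|≤k))))
... | inj₂ (R₀ , _ , p₀) with S
...   | [] = ∑-take-nonneg (0≤x ∷ 0≤L) (suc k)
...   | y ∷ S₁ = ℚ.+-mono-≤ (All.lookup x≥L (∈-resp-↭ p₀ (here refl)))
        (∑-sub-bag≤∑-take desc 0≤L k S₁ (y ∷ R₀) (↭-trans (shift y S₁ R₀) p₀) (s≤s⁻¹ |S|≤k))

≽⇒∑-take≤ : ∀ {G B} → AllPairs _≥_ G → All (0ℚ ≤_) G → G ≽ B →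
  ∀ k → ∑ (take k B) ≤ ∑ (take k G)
≽⇒∑-take≤ {G} {B} desc 0≤G G≽B k
  with S′ , R′ , p , len , le ← G≽B (take k B) (drop k B) (↭-reflexive (take++drop≡id k B)) =
  ℚ.≤-trans le (∑-sub-bag≤∑-take desc 0≤G k S′ R′ p |S′|≤k)
  where
  |S′|≤k : length S′ ≤ℕ k
  |S′|≤k = subst (_≤ℕ k) (sym (≡-trans len (length-take k B))) (ℕ.m⊓n≤m k (length B))

module _ {A : Set} where

  ∈-if⁻ : ∀ {z z′ : A} b → z ∈ (if b then [ z′ ] else []) → T b × z ≡ z′
  ∈-if⁻ true (here z≡z′) = _ , z≡z′

  ∈-if⁺ : ∀ {z : A} b → T b → z ∈ (if b then [ z ] else [])
  ∈-if⁺ true _ = here refl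

<ᵇ∧does⁻ : ∀ {m k} {P : Set} (P? : Dec P) → T ((m <ᵇ k) ∧ does P?) → m <ℕ k × P
<ᵇ∧does⁻ {m} {k} (yes p) h = ℕ.<ᵇ⇒< m k (proj₁ (Equivalence.to (T-∧ {m <ᵇ k}) h)) , p
<ᵇ∧does⁻ {m} {k} (no _) h = ⊥-elim (proj₂ (Equivalence.to (T-∧ {m <ᵇ k}) h))

<ᵇ∧does⁺ : ∀ {m k} {P : Set} (P? : Dec P) → m <ℕ k → P → T ((m <ᵇ k) ∧ does P?)
<ᵇ∧does⁺ (yes _) m<k _ = Equivalence.from T-∧ (ℕ.<⇒<ᵇ m<k , _)
<ᵇ∧does⁺ (no ¬p) _ p = ⊥-elim (¬p p)

does-∨-∧⁻ : ∀ {A B : Set} (A? : Dec A) (B? : Dec B) r →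
  does A? ∨ (does B? ∧ r) ≡ true → A ⊎ B
does-∨-∧⁻ (yes a) _ _ _ = inj₁ a
does-∨-∧⁻ (no _) (yes b) _ _ = inj₂ b

does-∨-∧-false⁻ : ∀ {A B : Set} (A? : Dec A) (B? : Dec B) r →
  does A? ∨ (does B? ∧ r) ≡ false → ¬ A
does-∨-∧-false⁻ (no ¬a) _ _ _ = ¬a

indicator : ∀ {P : Set} → Dec P → ℕ
indicator P? = if does P? then 1 else 0

module _ {P : Set} where

  indicator-yes : (P? : Dec P) → P → indicator P? ≡ 1
  indicator-yes (yes _) _ = refl
  indicator-yes (no ¬p) p = ⊥-elim (¬p p)

  indicator-no : (P? : Dec P) → ¬ P → indicator P? ≡ 0
  indicator-no (yes p) ¬p = ⊥-elim (¬p p)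
  indicator-no (no _) _ = refl

  indicator≤1 : (P? : Dec P) → indicator P? ≤ℕ 1
  indicator≤1 (yes _) = ℕ.≤-refl
  indicator≤1 (no _) = z≤n

  indicator-pos : (P? : Dec P) → 1 ≤ℕ indicator P? → P
  indicator-pos (yes p) _ = p

  indicator-cong : ∀ {Q : Set} (P? : Dec P) (Q? : Dec Q) → (P → Q) → (Q → P) →
    indicator P? ≡ indicator Q?
  indicator-cong (yes _) (yes _) _ _ = refl
  indicator-cong (yes p) (no ¬q) P→Q _ = ⊥-elim (¬q (P→Q p))
  indicator-cong (no ¬p) (yes q) _ Q→P = ⊥-elim (¬p (Q→P q))
  indicator-cong (no _) (no _) _ _ = refl

-- The summands of Threshold.occ, so occ v ((a , b) ∷ M) unfolds to δ a v +ℕ (δ b v +ℕ occ v M).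
δ : ∀ {m} → Fin m → Fin m → ℕ
δ a v = indicator (a ≟F v)

δ-refl : ∀ {m} (a : Fin m) → δ a a ≡ 1
δ-refl a = indicator-yes (a ≟F a) refl

δ-≢ : ∀ {m} {a v : Fin m} → a ≢ v → δ a v ≡ 0
δ-≢ {a = a} {v} = indicator-no (a ≟F v)

ℚ-+-cancelˡ-≤ : ∀ a b c → a + b ≤ a + c → b ≤ c
ℚ-+-cancelˡ-≤ a b c a+b≤a+c =
  ℚ.≮⇒≥ λ c<b → ℚ.<-irrefl refl (ℚ.<-≤-trans (ℚ.+-monoʳ-< a c<b) a+b≤a+c)

ℕ-+-swap-pairs : ∀ a b c d o → a +ℕ (b +ℕ (c +ℕ (d +ℕ o))) ≡ c +ℕ (d +ℕ (a +ℕ (b +ℕ o)))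
ℕ-+-swap-pairs = solve-∀

ℕ-+-swap-middle : ∀ a b c d o → a +ℕ (b +ℕ (c +ℕ (d +ℕ o))) ≡ a +ℕ (c +ℕ (b +ℕ (d +ℕ o)))
ℕ-+-swap-middle = solve-∀

∑-δ : ∀ {m} (a : Fin m) → ℕ∑.sum (δ a) ≡ 1
∑-δ {suc m} a = begin
  ℕ∑.sum (δ a)                          ≡⟨ ℕ∑.sum-remove {i = a} (δ a) ⟩
  δ a a +ℕ ℕ∑.sum (removeAt (δ a) a)    ≡⟨ cong₂ _+ℕ_ (δ-refl a) removed-zero ⟩
  1                                     ∎
  where
  open ≡-Reasoning
  removed-zero : ℕ∑.sum (removeAt (δ a) a) ≡ 0
  removed-zero =
    ≡-trans (ℕ∑.sum-cong-≗ (λ j → δ-≢ (punchInᵢ≢i a j ∘ sym))) (ℕ∑.sum-replicate-zero m)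

∑-1 : ∀ m → ℕ∑.sum {m} (λ _ → 1) ≡ m
∑-1 zero = refl
∑-1 (suc m) = cong suc (∑-1 m)

-- The greedy matching of a threshold graph

module GreedyMatching {n : ℕ} (w : Fin n → ℚ) (t : ℚ) (ord : Fin n → Fin n → ℕ) where

  open Threshold w t ord
  open DecMembership (_≟F_ {n}) using (_∈?_)

  IsEdge : Edge n → Set
  IsEdge e = Adj (proj₁ e) (proj₂ e)

  Adj-sym : ∀ {x y} → Adj x y → Adj y x
  Adj-sym {x} {y} (x≢y , x+y≤t) = x≢y ∘ sym , subst (_≤ t) (ℚ.+-comm (w x) (w y)) x+y≤t

  ahead⇒≥ : ∀ e f → ahead e f ≡ true → weight f ≤ weight e
  ahead⇒≥ e f h with does-∨-∧⁻ (weight f <? weight e) (weight e ≟ weight f) _ h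
  ... | inj₁ f<e = ℚ.<⇒≤ f<e
  ... | inj₂ e≡f = ℚ.≤-reflexive (sym e≡f)

  ¬ahead⇒≤ : ∀ e f → ahead e f ≡ false → weight e ≤ weight f
  ¬ahead⇒≤ e f h =
    ℚ.≮⇒≥ (does-∨-∧-false⁻ (weight f <? weight e) (weight e ≟ weight f) _ h)

  insert-↭ : ∀ e L → insert e L ↭ e ∷ L
  insert-↭ e [] = ↭-refl
  insert-↭ e (f ∷ L) with ahead e f
  ... | true = ↭-refl
  ... | false = ↭-trans (prep f (insert-↭ e L)) (swap f e ↭-refl)

  sortEdges-↭ : ∀ L → sortEdges L ↭ L
  sortEdges-↭ [] = ↭-refl
  sortEdges-↭ (e ∷ L) = ↭-trans (insert-↭ e (sortEdges L)) (prep e (sortEdges-↭ L))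

  insert-descending : ∀ e L → AllPairs _≥_ (map weight L) →
    AllPairs _≥_ (map weight (insert e L))
  insert-descending e [] [] = [] ∷ []
  insert-descending e (f ∷ L) (f≥L ∷ desc) with ahead e f in eq
  ... | true = (f≤e ∷ All.map (λ g≤f → ℚ.≤-trans g≤f f≤e) f≥L) ∷ f≥L ∷ desc
    where f≤e = ahead⇒≥ e f eq
  ... | false = All-resp-↭ (↭-sym (map⁺ weight (insert-↭ e L))) (¬ahead⇒≤ e f eq ∷ f≥L)
              ∷ insert-descending e L desc

  sortEdges-descending : ∀ L → AllPairs _≥_ (map weight (sortEdges L))
  sortEdges-descending [] = []
  sortEdges-descending (e ∷ L) = insert-descending e (sortEdges L) (sortEdges-descending L)

  best-∈ : ∀ e es → best e es ∈ e ∷ es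
  best-∈ e [] = here refl
  best-∈ e (f ∷ es) with ahead f e
  ... | true = there (best-∈ f es)
  ... | false with best-∈ e es
  ...   | here b≡e = here b≡e
  ...   | there b∈es = there (there b∈es)

  best-maximal : ∀ e es → All (λ g → weight g ≤ weight (best e es)) (e ∷ es)
  best-maximal e [] = ℚ.≤-refl ∷ []
  best-maximal e (f ∷ es) with ahead f e in eq
  ... | true with f≤ ∷ es≤ ← best-maximal f es = ℚ.≤-trans (ahead⇒≥ f e eq) f≤ ∷ f≤ ∷ es≤
  ... | false with e≤ ∷ es≤ ← best-maximal e es = e≤ ∷ ℚ.≤-trans (¬ahead⇒≤ f e eq) e≤ ∷ es≤

  ∈-candidates⁻ : ∀ {rem x y} → (x , y) ∈ candidates rem →
    x ∈ rem × y ∈ rem × toℕ x <ℕ toℕ y × w x + w y ≤ t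
  ∈-candidates⁻ {rem} e∈
    with x , x∈ , e∈x ← find (∈-concatMap⁻ _ {xs = rem} e∈)
    with y , y∈ , e∈xy ← find (∈-concatMap⁻ _ {xs = rem} e∈x)
    with ok , refl ← ∈-if⁻ ((toℕ x <ᵇ toℕ y) ∧ does ((w x + w y) ≤? t)) e∈xy =
    x∈ , y∈ , <ᵇ∧does⁻ ((w x + w y) ≤? t) ok

  ∈-candidates⁺ : ∀ {rem x y} → x ∈ rem → y ∈ rem → toℕ x <ℕ toℕ y → w x + w y ≤ t →
    (x , y) ∈ candidates rem
  ∈-candidates⁺ x∈ y∈ x<y x+y≤t =
    ∈-concatMap⁺ _ (Any.map (λ { refl → ∈-concatMap⁺ _ (Any.map (λ { refl →
      ∈-if⁺ _ (<ᵇ∧does⁺ ((w _ + w _) ≤? t) x<y x+y≤t) }) y∈) }) x∈)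

  ∈-removeV⁻ : ∀ {u v} us → u ∈ removeV v us → u ∈ us × u ≢ v
  ∈-removeV⁻ {u} {v} (a ∷ us) with a ≟F v
  ... | yes _ = λ u∈ → let u∈us , u≢v = ∈-removeV⁻ us u∈ in there u∈us , u≢v
  ... | no a≢v = λ where
    (here refl) → here refl , a≢v
    (there u∈) → let u∈us , u≢v = ∈-removeV⁻ us u∈ in there u∈us , u≢v

  ∈-removeV⁺ : ∀ {u v} us → u ∈ us → u ≢ v → u ∈ removeV v us
  ∈-removeV⁺ {u} {v} (a ∷ us) u∈ u≢v with a ≟F v | u∈
  ... | yes refl | here refl = ⊥-elim (u≢v refl)
  ... | yes _ | there u∈us = ∈-removeV⁺ us u∈us u≢v
  ... | no _ | here refl = here refl
  ... | no _ | there u∈us = there (∈-removeV⁺ us u∈us u≢v)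

  χ : List (Fin n) → Fin n → ℕ
  χ rem v = indicator (v ∈? rem)

  removeBoth : Fin n → Fin n → List (Fin n) → List (Fin n)
  removeBoth x y rem = removeV y (removeV x rem)

  ∈-removeBoth⁻ : ∀ {x y v} rem → v ∈ removeBoth x y rem → v ∈ rem × v ≢ x × v ≢ y
  ∈-removeBoth⁻ {x} rem v∈ with v∈′ , v≢y ← ∈-removeV⁻ (removeV x rem) v∈
                           with v∈rem , v≢x ← ∈-removeV⁻ rem v∈′ = v∈rem , v≢x , v≢y

  χ-removeBoth : ∀ {x y rem} → x ∈ rem → y ∈ rem → x ≢ y →
    ∀ v → χ rem v ≡ δ x v +ℕ (δ y v +ℕ χ (removeBoth x y rem) v)
  χ-removeBoth {x} {y} {rem} x∈ y∈ x≢y v with v ≟F x | v ≟F y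
  ... | yes refl | _
    rewrite indicator-yes (v ∈? rem) x∈ | δ-refl v | δ-≢ (x≢y ∘ sym)
          | indicator-no (v ∈? removeBoth v y rem) (λ v∈ → proj₁ (proj₂ (∈-removeBoth⁻ rem v∈)) refl)
          = refl
  ... | no v≢x | yes refl
    rewrite indicator-yes (v ∈? rem) y∈ | δ-refl v | δ-≢ x≢y
          | indicator-no (v ∈? removeBoth x v rem) (λ v∈ → proj₂ (proj₂ (∈-removeBoth⁻ rem v∈)) refl)
          = refl
  ... | no v≢x | no v≢y
    rewrite δ-≢ (v≢x ∘ sym) | δ-≢ (v≢y ∘ sym) =
    indicator-cong (v ∈? rem) (v ∈? removeBoth x y rem)
      (λ v∈ → ∈-removeV⁺ (removeV x rem) (∈-removeV⁺ rem v∈ v≢x) v≢y)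
      (λ v∈ → proj₁ (∈-removeBoth⁻ rem v∈))

  record Covers (rem : List (Fin n)) (M : List (Edge n)) : Set where
    constructor covers
    field occ≡χ : ∀ v → occ v M ≡ χ rem v
  open Covers

  IsPerfectMatchingOn : List (Fin n) → List (Edge n) → Set
  IsPerfectMatchingOn rem M = All IsEdge M × Covers rem M

  module _ {rem M} (cov : Covers rem M) where

    covers⇒∈ : ∀ {v} → 1 ≤ℕ occ v M → v ∈ rem
    covers⇒∈ {v} 1≤occ = indicator-pos (v ∈? rem) (subst (1 ≤ℕ_) (occ≡χ cov v) 1≤occ)

    ∈⇒covered : ∀ {v} → v ∈ rem → occ v M ≡ 1
    ∈⇒covered {v} v∈ = ≡-trans (occ≡χ cov v) (indicator-yes (v ∈? rem) v∈)

    covered≤1 : ∀ v → occ v M ≤ℕ 1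
    covered≤1 v = subst (_≤ℕ 1) (sym (occ≡χ cov v)) (indicator≤1 (v ∈? rem))

  occ-≤-∷ : ∀ e M v → occ v M ≤ℕ occ v (e ∷ M)
  occ-≤-∷ (c , d) M v = ℕ.≤-trans (ℕ.m≤n+m (occ v M) (δ d v)) (ℕ.m≤n+m _ (δ c v))

  endpoints-covered : ∀ {a b M} → (a , b) ∈ M → 1 ≤ℕ occ a M × 1 ≤ℕ occ b M
  endpoints-covered {M = (a , b) ∷ M} (here refl) =
    subst (_≤ℕ occ a ((a , b) ∷ M)) (δ-refl a) (ℕ.m≤m+n (δ a a) _) ,
    subst (_≤ℕ occ b ((a , b) ∷ M)) (δ-refl b)
      (ℕ.≤-trans (ℕ.m≤m+n (δ b b) (occ b M)) (ℕ.m≤n+m _ (δ a b)))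
  endpoints-covered {a} {b} {e ∷ M} (there ab∈) with 1≤a , 1≤b ← endpoints-covered ab∈ =
    ℕ.≤-trans 1≤a (occ-≤-∷ e M a) , ℕ.≤-trans 1≤b (occ-≤-∷ e M b)

  module _ {rem x y M} (cov : Covers rem ((x , y) ∷ M)) where

    covers-∷⇒≢ : x ≢ y
    covers-∷⇒≢ refl
      with s≤s () ← subst (λ k → k +ℕ (k +ℕ occ x M) ≤ℕ 1) (δ-refl x) (covered≤1 cov x)

    covers-∷⁻ : Covers (removeBoth x y rem) M
    covers-∷⁻ = covers λ v → ℕ.+-cancelˡ-≡ (δ y v) _ _ (ℕ.+-cancelˡ-≡ (δ x v) _ _
      (≡-trans (occ≡χ cov v)
        (χ-removeBoth (covers⇒∈ cov x-covered) (covers⇒∈ cov y-covered) covers-∷⇒≢ v)))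
      where
      x-covered : 1 ≤ℕ occ x ((x , y) ∷ M)
      x-covered = proj₁ (endpoints-covered {M = (x , y) ∷ M} (here refl))
      y-covered : 1 ≤ℕ occ y ((x , y) ∷ M)
      y-covered = proj₂ (endpoints-covered {M = (x , y) ∷ M} (here refl))

  covers-∷⁺ : ∀ {rem x y M} → x ∈ rem → y ∈ rem → x ≢ y →
    Covers (removeBoth x y rem) M → Covers rem ((x , y) ∷ M)
  covers-∷⁺ {x = x} {y} x∈ y∈ x≢y cov = covers λ v →
    ≡-trans (cong (λ k → δ x v +ℕ (δ y v +ℕ k)) (occ≡χ cov v)) (sym (χ-removeBoth x∈ y∈ x≢y v))

  infix 4 _≅_

  -- Identifies matchings up to reordering and flipping of edges.
  _≅_ : List (Edge n) → List (Edge n) → Set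
  B ≅ B′ = (∀ v → occ v B ≡ occ v B′) × map weight B ↭ map weight B′

  ≅-refl : ∀ {B} → B ≅ B
  ≅-refl = (λ _ → refl) , ↭-refl

  ≅-trans : ∀ {B B′ B″} → B ≅ B′ → B′ ≅ B″ → B ≅ B″
  ≅-trans (occ≡ , ws↭) (occ≡′ , ws↭′) = (λ v → ≡-trans (occ≡ v) (occ≡′ v)) , ↭-trans ws↭ ws↭′

  ≅-prep : ∀ {B B′} e → B ≅ B′ → e ∷ B ≅ e ∷ B′
  ≅-prep (a , b) (occ≡ , ws↭) = (λ v → cong (λ k → δ a v +ℕ (δ b v +ℕ k)) (occ≡ v)) , prep _ ws↭

  ≅-swap : ∀ e f B → e ∷ f ∷ B ≅ f ∷ e ∷ B
  ≅-swap (a , b) (c , d) B =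
    (λ v → ℕ-+-swap-pairs (δ a v) (δ b v) (δ c v) (δ d v) (occ v B)) , swap _ _ ↭-refl

  ≅-flip : ∀ a b B → (a , b) ∷ B ≅ (b , a) ∷ B
  ≅-flip a b B =
    (λ v → ℕ+.x∙yz≈y∙xz (δ a v) (δ b v) (occ v B)) ,
    ↭-reflexive (cong (_∷ _) (ℚ.+-comm (w a) (w b)))

  ≅-length : ∀ {B B′} → B ≅ B′ → length B ≡ length B′
  ≅-length {B} {B′} (_ , ws↭) =
    ≡-trans (sym (length-map weight B)) (≡-trans (↭-length ws↭) (length-map weight B′))

  ≅-covers : ∀ {rem B B′} → B ≅ B′ → Covers rem B → Covers rem B′
  ≅-covers (occ≡ , _) cov = covers λ v → ≡-trans (sym (occ≡ v)) (occ≡χ cov v)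

  MateIn : Fin n → List (Edge n) → Set
  MateIn x B = ∃[ x′ ] ∃[ R ] (B ≅ (x , x′) ∷ R × All IsEdge ((x , x′) ∷ R))

  mateIn-∷ : ∀ {x B} e → IsEdge e → MateIn x B → MateIn x (e ∷ B)
  mateIn-∷ e e-edge (x′ , R , B≅ , xx′ ∷ adjR) =
    x′ , e ∷ R , ≅-trans (≅-prep e B≅) (≅-swap e _ R) , xx′ ∷ e-edge ∷ adjR

  mateIn : ∀ {x B} → All IsEdge B → 1 ≤ℕ occ x B → MateIn x B
  mateIn {B = []} [] ()
  mateIn {x} {(a , b) ∷ M} (ab ∷ adjM) with a ≟F x | b ≟F x
  ... | yes refl | _ = λ _ → b , M , ≅-refl , ab ∷ adjM
  ... | no _ | yes refl = λ _ → a , M , ≅-flip a b M , Adj-sym ab ∷ adjM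
  ... | no _ | no _ = λ 1≤occ → mateIn-∷ (a , b) ab (mateIn adjM 1≤occ)

  HeaviestOn : List (Fin n) → ℚ → Set
  HeaviestOn rem m = ∀ {u v} → u ∈ rem → v ∈ rem → Adj u v → w u + w v ≤ m

  edge⇒candidate : ∀ {rem u v} → u ∈ rem → v ∈ rem → Adj u v →
    ∃[ e ] (e ∈ candidates rem × weight e ≡ w u + w v)
  edge⇒candidate {u = u} {v} u∈ v∈ (u≢v , u+v≤t) with ℕ.<-cmp (toℕ u) (toℕ v)
  ... | tri< u<v _ _ = (u , v) , ∈-candidates⁺ u∈ v∈ u<v u+v≤t , refl
  ... | tri≈ _ u≡v _ = ⊥-elim (u≢v (toℕ-injective u≡v))
  ... | tri> _ _ v<u =
    (v , u) , ∈-candidates⁺ v∈ u∈ v<u (subst (_≤ t) (ℚ.+-comm (w u) (w v)) u+v≤t) ,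
    ℚ.+-comm (w v) (w u)

  best-heaviest : ∀ {rem e es} → candidates rem ≡ e ∷ es → HeaviestOn rem (weight (best e es))
  best-heaviest {e = e} {es} eq u∈ v∈ uv with f , f∈ , f≡ ← edge⇒candidate u∈ v∈ uv =
    subst (_≤ weight (best e es)) f≡ (All.lookup (best-maximal e es) (subst (f ∈_) eq f∈))

  -- The threshold property: the only place where the threshold structure of the graph is used.
  lighter-adj : ∀ {u u′ v} → w u′ ≤ w u → Adj u v → u′ ≢ v → Adj u′ v
  lighter-adj {v = v} u′≤u (_ , u+v≤t) u′≢v = u′≢v , ℚ.≤-trans (ℚ.+-monoˡ-≤ (w v) u′≤u) u+v≤t

  DominatingOn : List (Fin n) → List (Edge n) → List (Edge n) → Set
  DominatingOn rem B G = IsPerfectMatchingOn rem G × map weight G ≽ map weight B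

  module GreedyStep {rem B x y G′} (B-perfect : IsPerfectMatchingOn rem B)
    (x∈ : x ∈ rem) (y∈ : y ∈ rem) (xy : Adj x y) (heaviest : HeaviestOn rem (w x + w y))
    (IH : ∀ {B′} → IsPerfectMatchingOn (removeBoth x y rem) B′ → length B′ <ℕ length B →
            DominatingOn (removeBoth x y rem) B′ G′)
    where

    extend : IsPerfectMatchingOn (removeBoth x y rem) G′ → IsPerfectMatchingOn rem ((x , y) ∷ G′)
    extend (adjG′ , cov) = xy ∷ adjG′ , covers-∷⁺ x∈ y∈ (proj₁ xy) cov

    mate-is-y : ∀ {R} → B ≅ (x , y) ∷ R → All IsEdge R → DominatingOn rem B ((x , y) ∷ G′)
    mate-is-y B≅ adjR
      with G′-perfect , G′≽R ← IH (adjR , covers-∷⁻ (≅-covers B≅ (proj₂ B-perfect)))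
                                   (ℕ.≤-reflexive (sym (≅-length B≅))) =
      extend G′-perfect , ≽-respʳ-↭ (↭-sym (proj₂ B≅)) (≽-prep (w x + w y) G′≽R)

    exchange : ∀ {x′ y′ R′} → B ≅ (x , x′) ∷ (y , y′) ∷ R′ →
      All IsEdge ((x , x′) ∷ (y , y′) ∷ R′) → DominatingOn rem B ((x , y) ∷ G′)
    exchange {x′} {y′} {R′} B≅ (xx′ ∷ yy′ ∷ adjR′) =
      extend (proj₁ G′-dominating) ,
      ≽-respʳ-↭ (↭-sym (proj₂ B≅))
        (≽-trans (≽-prep (w x + w y) (proj₂ G′-dominating))
          (exchange-≽ (map weight R′) (heaviest x∈ x′∈ xx′) (heaviest y∈ y′∈ yy′)
            (ℚ+.interchange (w x) (w x′) (w y) (w y′))))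
      where
      cov : Covers rem ((x , x′) ∷ (y , y′) ∷ R′)
      cov = ≅-covers B≅ (proj₂ B-perfect)
      x′∈ : x′ ∈ rem
      x′∈ = covers⇒∈ cov (proj₂ (endpoints-covered {M = (x , x′) ∷ (y , y′) ∷ R′} (here refl)))
      y′∈ : y′ ∈ rem
      y′∈ = covers⇒∈ cov
              (proj₂ (endpoints-covered {M = (x , x′) ∷ (y , y′) ∷ R′} (there (here refl))))
      cov′ : Covers (removeBoth x y rem) ((x′ , y′) ∷ R′)
      cov′ = covers-∷⁻ {rem} {x} {y} (covers λ v →
        ≡-trans (ℕ-+-swap-middle (δ x v) (δ y v) (δ x′ v) (δ y′ v) (occ v R′)) (occ≡χ cov v))
      x′y′ : Adj x′ y′
      x′y′ = lighter-adj (ℚ-+-cancelˡ-≤ (w x) (w x′) (w y) (heaviest x∈ x′∈ xx′)) yy′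
               (covers-∷⇒≢ cov′)
      G′-dominating : DominatingOn (removeBoth x y rem) ((x′ , y′) ∷ R′) G′
      G′-dominating = IH (x′y′ ∷ adjR′ , cov′) (ℕ.≤-reflexive (sym (≅-length B≅)))

    y-in-rest : ∀ {x′ R} → B ≅ (x , x′) ∷ R → x′ ≢ y → 1 ≤ℕ occ y R
    y-in-rest {x′} {R} B≅ x′≢y = ℕ.≤-reflexive (sym (begin
      occ y R               ≡⟨ cong₂ (λ a b → a +ℕ (b +ℕ occ y R)) (δ-≢ (proj₁ xy)) (δ-≢ x′≢y) ⟨
      occ y ((x , x′) ∷ R)  ≡⟨ ∈⇒covered (≅-covers B≅ (proj₂ B-perfect)) y∈ ⟩
      1                     ∎))
      where open ≡-Reasoning

    greedy-step : DominatingOn rem B ((x , y) ∷ G′)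
    greedy-step
      with x′ , R , B≅ , xx′ ∷ adjR
           ← mateIn (proj₁ B-perfect) (ℕ.≤-reflexive (sym (∈⇒covered (proj₂ B-perfect) x∈)))
      with x′ ≟F y
    ... | yes refl = mate-is-y B≅ adjR
    ... | no x′≢y with y′ , R′ , R≅ , yy′∷adjR′ ← mateIn adjR (y-in-rest B≅ x′≢y) =
      exchange (≅-trans B≅ (≅-prep (x , x′) R≅)) (xx′ ∷ yy′∷adjR′)

  covers-[]⇒[] : ∀ {rem} → Covers rem [] → rem ≡ []
  covers-[]⇒[] {[]} _ = refl
  covers-[]⇒[] {v ∷ rem} cov with () ← ∈⇒covered cov (here refl)

  candidate-exists : ∀ {rem e B} → IsPerfectMatchingOn rem (e ∷ B) → ∃[ f ] f ∈ candidates rem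
  candidate-exists {e = a , b} {B} (ab ∷ _ , cov) =
    let f , f∈ , _ = edge⇒candidate (covers⇒∈ cov (proj₁ ab-covered))
                                     (covers⇒∈ cov (proj₂ ab-covered)) ab
    in f , f∈
    where
    ab-covered = endpoints-covered {M = (a , b) ∷ B} (here refl)

  greedy-dominates : ∀ k rem B → IsPerfectMatchingOn rem B → length B ≤ℕ k →
    DominatingOn rem B (greedyFrom k rem)
  greedy-dominates zero rem [] B-perfect _ = B-perfect , []≽[]
  greedy-dominates (suc k) rem [] B-perfect _ with refl ← covers-[]⇒[] (proj₂ B-perfect) =
    B-perfect , []≽[]
  greedy-dominates (suc k) rem (_ ∷ _) B-perfect |B|≤ with candidates rem in eq
  ... | [] with f , f∈ ← candidate-exists B-perfect with () ← subst (f ∈_) eq f∈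
  ... | e ∷ es
    with x∈ , y∈ , x<y , x+y≤t ← ∈-candidates⁻ (subst (best e es ∈_) (sym eq) (best-∈ e es)) =
    GreedyStep.greedy-step B-perfect x∈ y∈ ((λ x≡y → ℕ.<-irrefl (cong toℕ x≡y) x<y) , x+y≤t)
      (best-heaviest eq)
      (λ B′-perfect B′<B → greedy-dominates k _ _ B′-perfect (ℕ.≤-pred (ℕ.≤-trans B′<B |B|≤)))

  perfect⇒on-allFin : ∀ {M} → IsPerfectMatching M → IsPerfectMatchingOn (allFin n) M
  perfect⇒on-allFin (adj , occ≡1) =
    adj , covers λ v → ≡-trans (occ≡1 v) (sym (indicator-yes (v ∈? allFin n) (∈-allFin v)))

  on-allFin⇒perfect : ∀ {M} → IsPerfectMatchingOn (allFin n) M → IsPerfectMatching M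
  on-allFin⇒perfect (adj , cov) = adj , λ v → ∈⇒covered cov (∈-allFin v)

  ∑-occ : ∀ M → ℕ∑.sum (λ v → occ v M) ≡ 2 * length M
  ∑-occ [] = ℕ∑.sum-replicate-zero n
  ∑-occ ((a , b) ∷ M) = begin
    ℕ∑.sum (λ v → δ a v +ℕ (δ b v +ℕ occ v M))
      ≡⟨ ℕ∑.∑-distrib-+ (δ a) _ ⟩
    ℕ∑.sum (δ a) +ℕ ℕ∑.sum (λ v → δ b v +ℕ occ v M)
      ≡⟨ cong (ℕ∑.sum (δ a) +ℕ_) (ℕ∑.∑-distrib-+ (δ b) _) ⟩
    ℕ∑.sum (δ a) +ℕ (ℕ∑.sum (δ b) +ℕ ℕ∑.sum (λ v → occ v M))
      ≡⟨ cong₂ _+ℕ_ (∑-δ a) (cong₂ _+ℕ_ (∑-δ b) (∑-occ M)) ⟩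
    2 +ℕ 2 * length M
      ≡⟨ ℕ.*-distribˡ-+ 2 1 (length M) ⟨
    2 * length ((a , b) ∷ M)
      ∎
    where open ≡-Reasoning

  perfect-length : ∀ {M} → IsPerfectMatching M → 2 * length M ≡ n
  perfect-length {M} (_ , occ≡1) =
    ≡-trans (sym (∑-occ M)) (≡-trans (ℕ∑.sum-cong-≗ occ≡1) (∑-1 n))

  ≽⇒topSum≤ : (∀ v → 0ℚ ≤ w v) → ∀ {G B} → map weight G ≽ map weight B →
    ∀ k → topSum k B ≤ topSum k G
  ≽⇒topSum≤ w≥0 {G} {B} G≽B k =
    subst₂ _≤_ (cong ∑ (take-map k (sortEdges B))) (cong ∑ (take-map k (sortEdges G)))
      (≽⇒∑-take≤ (sortEdges-descending G) weights≥0 sorted≽ k)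
    where
    sorted≽ : map weight (sortEdges G) ≽ map weight (sortEdges B)
    sorted≽ = ≽-respˡ-↭ (↭-sym (map⁺ weight (sortEdges-↭ G)))
                (≽-respʳ-↭ (↭-sym (map⁺ weight (sortEdges-↭ B))) G≽B)
    weights≥0 : All (0ℚ ≤_) (map weight (sortEdges G))
    weights≥0 = All.map⁺ (All.universal (λ (a , b) → ℚ.+-mono-≤ (w≥0 a) (w≥0 b)) _)

theorem9 : (c : ℕ) (w : Fin (2 * c) → ℚ) (t : ℚ) (ord : Fin (2 * c) → Fin (2 * c) → ℕ) →
    (∀ x → 0ℚ ≤ w x) → 0ℚ < t →
    Threshold.IsTieOrder w t ord →
    Σ[ M ∈ List (Edge (2 * c)) ] Threshold.IsPerfectMatching w t ord M →
    length (Threshold.greedy w t ord c) ≡ c ×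
      Threshold.IsDominantPerfectMatching w t ord c (Threshold.greedy w t ord c)
theorem9 c w t ord w≥0 _ _ (M , M-perfect) =
  half-length greedy-perfect , greedy-perfect ,
  λ B B-perfect k _ _ → ≽⇒topSum≤ w≥0 (proj₂ (dominating B-perfect)) k
  where
  open Threshold w t ord
  open GreedyMatching w t ord

  half-length : ∀ {B} → IsPerfectMatching B → length B ≡ c
  half-length {B} B-perfect = ℕ.*-cancelˡ-≡ (length B) c 2 (perfect-length B-perfect)

  dominating : ∀ {B} → IsPerfectMatching B → DominatingOn (allFin (2 * c)) B (greedy c)
  dominating {B} B-perfect =
    greedy-dominates c (allFin (2 * c)) B (perfect⇒on-allFin B-perfect)
      (ℕ.≤-reflexive (half-length B-perfect))

  greedy-perfect : IsPerfectMatching (greedy c)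
  greedy-perfect = on-allFin⇒perfect (proj₁ (dominating M-perfect))
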